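{- Let $m\ge 1$. For all integers $n\ge 0$ and $k\ge 0$, $$\sum_{l=\lceil k/m\rceil}^{n}\binom{n}{l}\binom{l}{k}_m=\sum_{j=0}^n2^{n-j}\binom{n}{j}\binom{j}{k-j}_{m-1},$$ and $$\sum_{l=k}^{mn}\binom{n}{l}_m\binom{l}{k}=\sum_{j=0}^n(-1)^{n-j}\binom{n}{j}\binom{(m+1)j}{k+n}.$$
   Context: For an integer $r\ge 0$ let $p_r(t)=1+t+\cdots+t^r$ (so $p_0=1$). For integers $N\ge 0$ and $j$, $\binom{N}{j}_r$ is the coefficient of $t^j$ in $p_r(t)^N$ for $j\ge 0$ and $0$ for $j<0$. Unsubscripted $\binom{a}{b}$ denotes the ordinary binomial coefficient (zero if $b>a\ge0$). -}

module Defs where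

open import Data.Nat using (ℕ; zero; suc; _+_; _*_; _∸_; NonZero)
open import Data.Nat.DivMod using (_/_)
open import Data.Integer as ℤ using (ℤ; +_; -[1+_])
open import Data.List using (List; []; _∷_; map; sum; upTo; replicate)

-- Polynomials over ℕ as coefficient lists (lowest degree first).
Poly : Set
Poly = List ℕ

addP : Poly → Poly → Poly
addP [] q = q
addP (a ∷ p) [] = a ∷ p
addP (a ∷ p) (b ∷ q) = (a + b) ∷ addP p q

scaleP : ℕ → Poly → Poly
scaleP c p = map (c *_) p

mulP : Poly → Poly → Poly
mulP [] q = []
mulP (a ∷ p) q = addP (scaleP a q) (0 ∷ mulP p q)

powP : Poly → ℕ → Poly
powP p zero = 1 ∷ []
powP p (suc n) = mulP p (powP p n)

coeff : Poly → ℕ → ℕ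
coeff [] j = 0
coeff (a ∷ p) zero = a
coeff (a ∷ p) (suc j) = coeff p j

pr : ℕ → Poly
pr r = replicate (suc r) 1

-- (N choose j)_r for j ≥ 0 : coefficient of t^j in p_r(t)^N
binomR : ℕ → ℕ → ℕ → ℕ
binomR r N j = coeff (powP (pr r) N) j

binomRℤ : ℕ → ℕ → ℤ → ℕ
binomRℤ r N (+ j) = binomR r N j
binomRℤ r N -[1+ _ ] = 0

-- sum_{l=a}^{b} f l (empty if a > b)
sumFT : {A : Set} → (A → A → A) → A → ℕ → ℕ → (ℕ → A) → A
sumFT _⊕_ e a b f = Data.List.foldr _⊕_ e (map (λ i → f (a + i)) (upTo (suc b ∸ a)))

Σℕ[_,_] : ℕ → ℕ → (ℕ → ℕ) → ℕ
Σℕ[ a , b ] f = sumFT _+_ 0 a b f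

Σℤ[_,_] : ℕ → ℕ → (ℕ → ℤ) → ℤ
Σℤ[ a , b ] f = sumFT ℤ._+_ (+ 0) a b f

ceilDiv : ℕ → (m : ℕ) → .{{NonZero m}} → ℕ
ceilDiv k m = (k + (m ∸ 1)) / m

{-# OPTIONS --safe #-}

-- Both identities read off one coefficient from two binomial expansions of the
-- same power. Since 1 + p_m(t) = 2 + t p_{m-1}(t), expanding (1 + p_m(t))^n
-- in both forms and comparing [t^k] gives the first identity. For the second,
-- put t = 1 + x: the geometric sum gives x p_m(1 + x) = (1 + x)^{m+1} - 1, so
-- [x^k] p_m(1 + x)^n = [x^{n+k}] ((1 + x)^{m+1} - 1)^n; the left-hand side
-- comes from writing p_m(t)^n in powers of t = 1 + x, the right-hand side from
-- the binomial theorem. Integer polynomials are modelled as coefficient lists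
-- up to coefficientwise equality, which form a commutative semiring, so the
-- binomial theorem and the semiring solver apply to them.

module Submission where

open import Defs
open import Data.Nat using (ℕ; zero; suc; _+_; _*_; _∸_; _^_; _≤_; _<_; _⊔_; z≤n; s≤s; NonZero)
import Data.Nat.Properties as ℕP
import Data.Nat.Tactic.RingSolver as ℕSolver
open import Data.Nat.DivMod using (m/n*n≤m)
open import Data.Nat.Combinatorics using (_C_; nCk+nC[k+1]≡[n+1]C[k+1]; k>n⇒nCk≡0)
open import Data.Integer as ℤ using (ℤ; +_)
import Data.Integer.Properties as ℤP
open import Data.Integer.Tactic.RingSolver using (solve-∀)
open import Data.List using (List; []; _∷_; length; map; foldr; applyUpTo; drop; replicate)
open import Data.List.Properties using (length-map; length-replicate)
open import Data.Fin using (Fin; toℕ)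
open import Data.Product using (_×_; _,_)
open import Function using (_∘_)
open import Relation.Nullary using (yes; no)
open import Relation.Binary.PropositionalEquality
open import Relation.Binary.Bundles using (Setoid)
open import Relation.Binary.Structures using (IsEquivalence)
import Relation.Binary.Reasoning.Setoid
open import Algebra.Bundles using (CommutativeSemiring)
open import Algebra.Structures.Biased using (IsCommutativeSemiringˡ)

module _ {A : Set} (_∙_ : A → A → A) (ε : A) where

  ⨁< : ℕ → (ℕ → A) → A
  ⨁< zero f = ε
  ⨁< (suc n) f = f 0 ∙ ⨁< n (f ∘ suc)

  ⨁<-cong : ∀ n {f g : ℕ → A} → (∀ i → f i ≡ g i) → ⨁< n f ≡ ⨁< n g
  ⨁<-cong zero eq = refl
  ⨁<-cong (suc n) eq = cong₂ _∙_ (eq 0) (⨁<-cong n (eq ∘ suc))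

  foldr-map-applyUpTo : ∀ (g : ℕ → A) (h : ℕ → ℕ) n →
    foldr _∙_ ε (map g (applyUpTo h n)) ≡ ⨁< n (g ∘ h)
  foldr-map-applyUpTo g h zero = refl
  foldr-map-applyUpTo g h (suc n) = cong (g (h 0) ∙_) (foldr-map-applyUpTo g (h ∘ suc) n)

  module _ (identityˡ : ∀ x → ε ∙ x ≡ x) where

    ⨁<-drop-prefix : ∀ a N f → (∀ l → l < a → f l ≡ ε) →
      ⨁< (N ∸ a) (λ i → f (a + i)) ≡ ⨁< N f
    ⨁<-drop-prefix zero N f _ = refl
    ⨁<-drop-prefix (suc a) zero f _ = refl
    ⨁<-drop-prefix (suc a) (suc N) f vanish = begin
      ⨁< (N ∸ a) (λ i → f (suc a + i))  ≡⟨ ⨁<-drop-prefix a N (f ∘ suc) (λ l l<a → vanish (suc l) (s≤s l<a)) ⟩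
      ⨁< N (f ∘ suc)                    ≡⟨ identityˡ _ ⟨
      ε ∙ ⨁< N (f ∘ suc)                ≡⟨ cong (_∙ ⨁< N (f ∘ suc)) (vanish 0 (s≤s z≤n)) ⟨
      f 0 ∙ ⨁< N (f ∘ suc)              ∎
      where open ≡-Reasoning

    sumFT≡⨁< : ∀ a n f → (∀ l → l < a → f l ≡ ε) → sumFT _∙_ ε a n f ≡ ⨁< (suc n) f
    sumFT≡⨁< a n f vanish =
      trans (foldr-map-applyUpTo (λ i → f (a + i)) (λ i → i) (suc n ∸ a))
            (⨁<-drop-prefix a (suc n) f vanish)

⨁<-hom : ∀ {A B : Set} {_∙_ : A → A → A} {ε : A} {_◦_ : B → B → B} {ε′ : B} (h : A → B) →
  h ε ≡ ε′ → (∀ x y → h (x ∙ y) ≡ h x ◦ h y) →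
  ∀ n f → h (⨁< _∙_ ε n f) ≡ ⨁< _◦_ ε′ n (h ∘ f)
⨁<-hom h hε h∙ zero f = hε
⨁<-hom {_◦_ = _◦_} h hε h∙ (suc n) f =
  trans (h∙ (f 0) _) (cong (h (f 0) ◦_) (⨁<-hom h hε h∙ n (f ∘ suc)))

∑ℕ< : ℕ → (ℕ → ℕ) → ℕ
∑ℕ< = ⨁< _+_ 0

∑ℤ< : ℕ → (ℕ → ℤ) → ℤ
∑ℤ< = ⨁< ℤ._+_ (+ 0)

pos-∑ℕ< : ∀ n f → + ∑ℕ< n f ≡ ∑ℤ< n (+_ ∘ f)
pos-∑ℕ< = ⨁<-hom +_ refl ℤP.pos-+

-- Polynomials with integer coefficients

ℤPoly : Set
ℤPoly = List ℤ

infixl 6 _+ᵖ_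
infixl 7 _*ᵖ_ _·ᵖ_
infix 4 _≋_

_+ᵖ_ : ℤPoly → ℤPoly → ℤPoly
[] +ᵖ q = q
(a ∷ p) +ᵖ [] = a ∷ p
(a ∷ p) +ᵖ (b ∷ q) = (a ℤ.+ b) ∷ (p +ᵖ q)

_·ᵖ_ : ℤ → ℤPoly → ℤPoly
c ·ᵖ p = map (c ℤ.*_) p

_*ᵖ_ : ℤPoly → ℤPoly → ℤPoly
[] *ᵖ q = []
(a ∷ p) *ᵖ q = a ·ᵖ q +ᵖ (+ 0 ∷ p *ᵖ q)

coeffᵖ : ℤPoly → ℕ → ℤ
coeffᵖ [] j = + 0
coeffᵖ (a ∷ p) zero = a
coeffᵖ (a ∷ p) (suc j) = coeffᵖ p j

-- Being a function type, p ≋ q does not determine p and q, which is why the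
-- implicit polynomial arguments of congruence lemmas are often given below.
_≋_ : ℤPoly → ℤPoly → Set
p ≋ q = ∀ j → coeffᵖ p j ≡ coeffᵖ q j

≋-isEquivalence : IsEquivalence _≋_
≋-isEquivalence = record
  { refl = λ j → refl
  ; sym = λ p≋q j → sym (p≋q j)
  ; trans = λ p≋q q≋r j → trans (p≋q j) (q≋r j)
  }

≋-setoid : Setoid _ _
≋-setoid = record { isEquivalence = ≋-isEquivalence }

module ≋-Reasoning = Relation.Binary.Reasoning.Setoid ≋-setoid

coeff-+ᵖ : ∀ p q j → coeffᵖ (p +ᵖ q) j ≡ coeffᵖ p j ℤ.+ coeffᵖ q j
coeff-+ᵖ [] q j = sym (ℤP.+-identityˡ _)
coeff-+ᵖ (a ∷ p) [] j = sym (ℤP.+-identityʳ _)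
coeff-+ᵖ (a ∷ p) (b ∷ q) zero = refl
coeff-+ᵖ (a ∷ p) (b ∷ q) (suc j) = coeff-+ᵖ p q j

coeff-·ᵖ : ∀ c p j → coeffᵖ (c ·ᵖ p) j ≡ c ℤ.* coeffᵖ p j
coeff-·ᵖ c [] j = sym (ℤP.*-zeroʳ c)
coeff-·ᵖ c (a ∷ p) zero = refl
coeff-·ᵖ c (a ∷ p) (suc j) = coeff-·ᵖ c p j

coeff-drop1 : ∀ p j → coeffᵖ (drop 1 p) j ≡ coeffᵖ p (suc j)
coeff-drop1 [] j = refl
coeff-drop1 (a ∷ p) j = refl

drop1-cong : ∀ p q → p ≋ q → drop 1 p ≋ drop 1 q
drop1-cong p q p≋q j = trans (coeff-drop1 p j) (trans (p≋q (suc j)) (sym (coeff-drop1 q j)))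

-- Uniform in p (including p = []), so that the semiring laws can be proved by
-- induction on the coefficient index alone.
coeff-*ᵖ-zero : ∀ p q → coeffᵖ (p *ᵖ q) 0 ≡ coeffᵖ p 0 ℤ.* coeffᵖ q 0
coeff-*ᵖ-zero [] q = sym (ℤP.*-zeroˡ (coeffᵖ q 0))
coeff-*ᵖ-zero (a ∷ p) q =
  trans (coeff-+ᵖ (a ·ᵖ q) (+ 0 ∷ p *ᵖ q) 0)
        (trans (ℤP.+-identityʳ (coeffᵖ (a ·ᵖ q) 0)) (coeff-·ᵖ a q 0))

coeff-*ᵖ-suc : ∀ p q j →
  coeffᵖ (p *ᵖ q) (suc j) ≡ coeffᵖ p 0 ℤ.* coeffᵖ q (suc j) ℤ.+ coeffᵖ (drop 1 p *ᵖ q) j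
coeff-*ᵖ-suc [] q j = sym (trans (ℤP.+-identityʳ (+ 0 ℤ.* coeffᵖ q (suc j))) (ℤP.*-zeroˡ (coeffᵖ q (suc j))))
coeff-*ᵖ-suc (a ∷ p) q j =
  trans (coeff-+ᵖ (a ·ᵖ q) (+ 0 ∷ p *ᵖ q) (suc j)) (cong (ℤ._+ coeffᵖ (p *ᵖ q) j) (coeff-·ᵖ a q (suc j)))

coeff-*ᵖ-sucʳ : ∀ p q j →
  coeffᵖ (p *ᵖ q) (suc j) ≡ coeffᵖ p (suc j) ℤ.* coeffᵖ q 0 ℤ.+ coeffᵖ (p *ᵖ drop 1 q) j
coeff-*ᵖ-sucʳ p q zero = begin
  coeffᵖ (p *ᵖ q) 1                                  ≡⟨ coeff-*ᵖ-suc p q 0 ⟩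
  p₀ ℤ.* coeffᵖ q 1 ℤ.+ coeffᵖ (drop 1 p *ᵖ q) 0    ≡⟨ cong₂ (λ x y → p₀ ℤ.* x ℤ.+ y) (sym (coeff-drop1 q 0))
                                                         (trans (coeff-*ᵖ-zero (drop 1 p) q) (cong (ℤ._* q₀) (coeff-drop1 p 0))) ⟩
  p₀ ℤ.* coeffᵖ (drop 1 q) 0 ℤ.+ coeffᵖ p 1 ℤ.* q₀  ≡⟨ ℤP.+-comm (p₀ ℤ.* coeffᵖ (drop 1 q) 0) (coeffᵖ p 1 ℤ.* q₀) ⟩
  coeffᵖ p 1 ℤ.* q₀ ℤ.+ p₀ ℤ.* coeffᵖ (drop 1 q) 0  ≡⟨ cong (ℤ._+_ (coeffᵖ p 1 ℤ.* q₀)) (coeff-*ᵖ-zero p (drop 1 q)) ⟨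
  coeffᵖ p 1 ℤ.* q₀ ℤ.+ coeffᵖ (p *ᵖ drop 1 q) 0    ∎
  where
  open ≡-Reasoning
  p₀ = coeffᵖ p 0
  q₀ = coeffᵖ q 0
coeff-*ᵖ-sucʳ p q (suc j) = begin
  coeffᵖ (p *ᵖ q) (suc (suc j))
    ≡⟨ coeff-*ᵖ-suc p q (suc j) ⟩
  p₀ ℤ.* coeffᵖ q (suc (suc j)) ℤ.+ coeffᵖ (drop 1 p *ᵖ q) (suc j)
    ≡⟨ cong (ℤ._+_ (p₀ ℤ.* coeffᵖ q (suc (suc j)))) (coeff-*ᵖ-sucʳ (drop 1 p) q j) ⟩
  p₀ ℤ.* coeffᵖ q (suc (suc j)) ℤ.+ (coeffᵖ (drop 1 p) (suc j) ℤ.* q₀ ℤ.+ r)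
    ≡⟨ swap-summands (p₀ ℤ.* coeffᵖ q (suc (suc j))) (coeffᵖ (drop 1 p) (suc j) ℤ.* q₀) r ⟩
  coeffᵖ (drop 1 p) (suc j) ℤ.* q₀ ℤ.+ (p₀ ℤ.* coeffᵖ q (suc (suc j)) ℤ.+ r)
    ≡⟨ cong₂ (λ x y → x ℤ.* q₀ ℤ.+ (p₀ ℤ.* y ℤ.+ r)) (coeff-drop1 p (suc j)) (sym (coeff-drop1 q (suc j))) ⟩
  coeffᵖ p (suc (suc j)) ℤ.* q₀ ℤ.+ (p₀ ℤ.* coeffᵖ (drop 1 q) (suc j) ℤ.+ r)
    ≡⟨ cong (ℤ._+_ (coeffᵖ p (suc (suc j)) ℤ.* q₀)) (coeff-*ᵖ-suc p (drop 1 q) j) ⟨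
  coeffᵖ p (suc (suc j)) ℤ.* q₀ ℤ.+ coeffᵖ (p *ᵖ drop 1 q) (suc j) ∎
  where
  open ≡-Reasoning
  p₀ = coeffᵖ p 0
  q₀ = coeffᵖ q 0
  r = coeffᵖ (drop 1 p *ᵖ drop 1 q) j
  swap-summands : ∀ x y z → x ℤ.+ (y ℤ.+ z) ≡ y ℤ.+ (x ℤ.+ z)
  swap-summands = solve-∀

∷-cong : ∀ a {p q} → p ≋ q → a ∷ p ≋ a ∷ q
∷-cong a p≋q zero = refl
∷-cong a p≋q (suc j) = p≋q j

+ᵖ-cong : ∀ {p p′ q q′} → p ≋ p′ → q ≋ q′ → p +ᵖ q ≋ p′ +ᵖ q′
+ᵖ-cong {p} {p′} {q} {q′} p≋p′ q≋q′ j =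
  trans (coeff-+ᵖ p q j) (trans (cong₂ ℤ._+_ (p≋p′ j) (q≋q′ j)) (sym (coeff-+ᵖ p′ q′ j)))

+ᵖ-assoc : ∀ p q r → (p +ᵖ q) +ᵖ r ≋ p +ᵖ (q +ᵖ r)
+ᵖ-assoc p q r j = begin
  coeffᵖ ((p +ᵖ q) +ᵖ r) j                 ≡⟨ coeff-+ᵖ (p +ᵖ q) r j ⟩
  coeffᵖ (p +ᵖ q) j ℤ.+ coeffᵖ r j         ≡⟨ cong (ℤ._+ coeffᵖ r j) (coeff-+ᵖ p q j) ⟩
  coeffᵖ p j ℤ.+ coeffᵖ q j ℤ.+ coeffᵖ r j ≡⟨ ℤP.+-assoc (coeffᵖ p j) (coeffᵖ q j) (coeffᵖ r j) ⟩
  coeffᵖ p j ℤ.+ (coeffᵖ q j ℤ.+ coeffᵖ r j) ≡⟨ cong (ℤ._+_ (coeffᵖ p j)) (coeff-+ᵖ q r j) ⟨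
  coeffᵖ p j ℤ.+ coeffᵖ (q +ᵖ r) j         ≡⟨ coeff-+ᵖ p (q +ᵖ r) j ⟨
  coeffᵖ (p +ᵖ (q +ᵖ r)) j                 ∎
  where open ≡-Reasoning

+ᵖ-comm : ∀ p q → p +ᵖ q ≋ q +ᵖ p
+ᵖ-comm p q j =
  trans (coeff-+ᵖ p q j) (trans (ℤP.+-comm (coeffᵖ p j) (coeffᵖ q j)) (sym (coeff-+ᵖ q p j)))

+ᵖ-identityʳ : ∀ p → p +ᵖ [] ≋ p
+ᵖ-identityʳ p j = trans (coeff-+ᵖ p [] j) (ℤP.+-identityʳ (coeffᵖ p j))

*ᵖ-congˡ : ∀ {p p′} q → p ≋ p′ → p *ᵖ q ≋ p′ *ᵖ q
*ᵖ-congˡ {p} {p′} q p≋p′ zero =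
  trans (coeff-*ᵖ-zero p q) (trans (cong (ℤ._* coeffᵖ q 0) (p≋p′ 0)) (sym (coeff-*ᵖ-zero p′ q)))
*ᵖ-congˡ {p} {p′} q p≋p′ (suc j) =
  trans (coeff-*ᵖ-suc p q j)
        (trans (cong₂ ℤ._+_ (cong (ℤ._* coeffᵖ q (suc j)) (p≋p′ 0)) (*ᵖ-congˡ {drop 1 p} {drop 1 p′} q (drop1-cong p p′ p≋p′) j))
               (sym (coeff-*ᵖ-suc p′ q j)))

*ᵖ-congʳ : ∀ p {q q′} → q ≋ q′ → p *ᵖ q ≋ p *ᵖ q′
*ᵖ-congʳ p {q} {q′} q≋q′ zero =
  trans (coeff-*ᵖ-zero p q) (trans (cong (coeffᵖ p 0 ℤ.*_) (q≋q′ 0)) (sym (coeff-*ᵖ-zero p q′)))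
*ᵖ-congʳ p {q} {q′} q≋q′ (suc j) =
  trans (coeff-*ᵖ-suc p q j)
        (trans (cong₂ ℤ._+_ (cong (coeffᵖ p 0 ℤ.*_) (q≋q′ (suc j))) (*ᵖ-congʳ (drop 1 p) {q} {q′} q≋q′ j))
               (sym (coeff-*ᵖ-suc p q′ j)))

*ᵖ-cong : ∀ {p p′ q q′} → p ≋ p′ → q ≋ q′ → p *ᵖ q ≋ p′ *ᵖ q′
*ᵖ-cong {p} {p′} {q} {q′} p≋p′ q≋q′ j = trans (*ᵖ-congˡ {p} {p′} q p≋p′ j) (*ᵖ-congʳ p′ {q} {q′} q≋q′ j)

*ᵖ-comm : ∀ p q → p *ᵖ q ≋ q *ᵖ p
*ᵖ-comm p q zero =
  trans (coeff-*ᵖ-zero p q) (trans (ℤP.*-comm (coeffᵖ p 0) (coeffᵖ q 0)) (sym (coeff-*ᵖ-zero q p)))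
*ᵖ-comm p q (suc j) =
  trans (coeff-*ᵖ-suc p q j)
        (trans (cong₂ ℤ._+_ (ℤP.*-comm (coeffᵖ p 0) (coeffᵖ q (suc j))) (*ᵖ-comm (drop 1 p) q j))
               (sym (coeff-*ᵖ-sucʳ q p j)))

drop1-+ᵖ : ∀ p q → drop 1 (p +ᵖ q) ≋ drop 1 p +ᵖ drop 1 q
drop1-+ᵖ p q j = begin
  coeffᵖ (drop 1 (p +ᵖ q)) j                        ≡⟨ coeff-drop1 (p +ᵖ q) j ⟩
  coeffᵖ (p +ᵖ q) (suc j)                           ≡⟨ coeff-+ᵖ p q (suc j) ⟩
  coeffᵖ p (suc j) ℤ.+ coeffᵖ q (suc j)             ≡⟨ cong₂ ℤ._+_ (coeff-drop1 p j) (coeff-drop1 q j) ⟨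
  coeffᵖ (drop 1 p) j ℤ.+ coeffᵖ (drop 1 q) j       ≡⟨ coeff-+ᵖ (drop 1 p) (drop 1 q) j ⟨
  coeffᵖ (drop 1 p +ᵖ drop 1 q) j                   ∎
  where open ≡-Reasoning

*ᵖ-distribʳ : ∀ r p q → (p +ᵖ q) *ᵖ r ≋ p *ᵖ r +ᵖ q *ᵖ r
*ᵖ-distribʳ r p q zero = begin
  coeffᵖ ((p +ᵖ q) *ᵖ r) 0                     ≡⟨ coeff-*ᵖ-zero (p +ᵖ q) r ⟩
  coeffᵖ (p +ᵖ q) 0 ℤ.* r₀                     ≡⟨ cong (ℤ._* r₀) (coeff-+ᵖ p q 0) ⟩
  (coeffᵖ p 0 ℤ.+ coeffᵖ q 0) ℤ.* r₀           ≡⟨ ℤP.*-distribʳ-+ r₀ (coeffᵖ p 0) (coeffᵖ q 0) ⟩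
  coeffᵖ p 0 ℤ.* r₀ ℤ.+ coeffᵖ q 0 ℤ.* r₀      ≡⟨ cong₂ ℤ._+_ (coeff-*ᵖ-zero p r) (coeff-*ᵖ-zero q r) ⟨
  coeffᵖ (p *ᵖ r) 0 ℤ.+ coeffᵖ (q *ᵖ r) 0      ≡⟨ coeff-+ᵖ (p *ᵖ r) (q *ᵖ r) 0 ⟨
  coeffᵖ (p *ᵖ r +ᵖ q *ᵖ r) 0                  ∎
  where
  open ≡-Reasoning
  r₀ = coeffᵖ r 0
*ᵖ-distribʳ r p q (suc j) = begin
  coeffᵖ ((p +ᵖ q) *ᵖ r) (suc j)
    ≡⟨ coeff-*ᵖ-suc (p +ᵖ q) r j ⟩
  coeffᵖ (p +ᵖ q) 0 ℤ.* r′ ℤ.+ coeffᵖ (drop 1 (p +ᵖ q) *ᵖ r) j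
    ≡⟨ cong₂ (λ x y → x ℤ.* r′ ℤ.+ y) (coeff-+ᵖ p q 0) tails ⟩
  (coeffᵖ p 0 ℤ.+ coeffᵖ q 0) ℤ.* r′ ℤ.+ (coeffᵖ (drop 1 p *ᵖ r) j ℤ.+ coeffᵖ (drop 1 q *ᵖ r) j)
    ≡⟨ interchange (coeffᵖ p 0) (coeffᵖ q 0) r′ (coeffᵖ (drop 1 p *ᵖ r) j) (coeffᵖ (drop 1 q *ᵖ r) j) ⟩
  (coeffᵖ p 0 ℤ.* r′ ℤ.+ coeffᵖ (drop 1 p *ᵖ r) j) ℤ.+ (coeffᵖ q 0 ℤ.* r′ ℤ.+ coeffᵖ (drop 1 q *ᵖ r) j)
    ≡⟨ cong₂ ℤ._+_ (coeff-*ᵖ-suc p r j) (coeff-*ᵖ-suc q r j) ⟨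
  coeffᵖ (p *ᵖ r) (suc j) ℤ.+ coeffᵖ (q *ᵖ r) (suc j)
    ≡⟨ coeff-+ᵖ (p *ᵖ r) (q *ᵖ r) (suc j) ⟨
  coeffᵖ (p *ᵖ r +ᵖ q *ᵖ r) (suc j) ∎
  where
  open ≡-Reasoning
  r′ = coeffᵖ r (suc j)
  tails : coeffᵖ (drop 1 (p +ᵖ q) *ᵖ r) j ≡ coeffᵖ (drop 1 p *ᵖ r) j ℤ.+ coeffᵖ (drop 1 q *ᵖ r) j
  tails = trans (*ᵖ-congˡ {drop 1 (p +ᵖ q)} {drop 1 p +ᵖ drop 1 q} r (drop1-+ᵖ p q) j)
                (trans (*ᵖ-distribʳ r (drop 1 p) (drop 1 q) j) (coeff-+ᵖ (drop 1 p *ᵖ r) (drop 1 q *ᵖ r) j))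
  interchange : ∀ a b c x y → (a ℤ.+ b) ℤ.* c ℤ.+ (x ℤ.+ y) ≡ (a ℤ.* c ℤ.+ x) ℤ.+ (b ℤ.* c ℤ.+ y)
  interchange = solve-∀

drop1-·ᵖ : ∀ c p → drop 1 (c ·ᵖ p) ≋ c ·ᵖ drop 1 p
drop1-·ᵖ c [] j = refl
drop1-·ᵖ c (a ∷ p) j = refl

·ᵖ-*ᵖ-assoc : ∀ c p r → (c ·ᵖ p) *ᵖ r ≋ c ·ᵖ (p *ᵖ r)
·ᵖ-*ᵖ-assoc c p r zero = begin
  coeffᵖ ((c ·ᵖ p) *ᵖ r) 0             ≡⟨ coeff-*ᵖ-zero (c ·ᵖ p) r ⟩
  coeffᵖ (c ·ᵖ p) 0 ℤ.* coeffᵖ r 0     ≡⟨ cong (ℤ._* coeffᵖ r 0) (coeff-·ᵖ c p 0) ⟩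
  c ℤ.* coeffᵖ p 0 ℤ.* coeffᵖ r 0      ≡⟨ ℤP.*-assoc c (coeffᵖ p 0) (coeffᵖ r 0) ⟩
  c ℤ.* (coeffᵖ p 0 ℤ.* coeffᵖ r 0)    ≡⟨ cong (c ℤ.*_) (coeff-*ᵖ-zero p r) ⟨
  c ℤ.* coeffᵖ (p *ᵖ r) 0              ≡⟨ coeff-·ᵖ c (p *ᵖ r) 0 ⟨
  coeffᵖ (c ·ᵖ (p *ᵖ r)) 0             ∎
  where open ≡-Reasoning
·ᵖ-*ᵖ-assoc c p r (suc j) = begin
  coeffᵖ ((c ·ᵖ p) *ᵖ r) (suc j)
    ≡⟨ coeff-*ᵖ-suc (c ·ᵖ p) r j ⟩
  coeffᵖ (c ·ᵖ p) 0 ℤ.* r′ ℤ.+ coeffᵖ (drop 1 (c ·ᵖ p) *ᵖ r) j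
    ≡⟨ cong₂ (λ x y → x ℤ.* r′ ℤ.+ y) (coeff-·ᵖ c p 0) tail ⟩
  c ℤ.* coeffᵖ p 0 ℤ.* r′ ℤ.+ c ℤ.* coeffᵖ (drop 1 p *ᵖ r) j
    ≡⟨ factor c (coeffᵖ p 0) r′ (coeffᵖ (drop 1 p *ᵖ r) j) ⟩
  c ℤ.* (coeffᵖ p 0 ℤ.* r′ ℤ.+ coeffᵖ (drop 1 p *ᵖ r) j)
    ≡⟨ cong (c ℤ.*_) (coeff-*ᵖ-suc p r j) ⟨
  c ℤ.* coeffᵖ (p *ᵖ r) (suc j)
    ≡⟨ coeff-·ᵖ c (p *ᵖ r) (suc j) ⟨
  coeffᵖ (c ·ᵖ (p *ᵖ r)) (suc j) ∎
  where
  open ≡-Reasoning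
  r′ = coeffᵖ r (suc j)
  tail : coeffᵖ (drop 1 (c ·ᵖ p) *ᵖ r) j ≡ c ℤ.* coeffᵖ (drop 1 p *ᵖ r) j
  tail = trans (*ᵖ-congˡ {drop 1 (c ·ᵖ p)} {c ·ᵖ drop 1 p} r (drop1-·ᵖ c p) j)
               (trans (·ᵖ-*ᵖ-assoc c (drop 1 p) r j) (coeff-·ᵖ c (drop 1 p *ᵖ r) j))
  factor : ∀ c a x y → c ℤ.* a ℤ.* x ℤ.+ c ℤ.* y ≡ c ℤ.* (a ℤ.* x ℤ.+ y)
  factor = solve-∀

0∷-*ᵖ : ∀ p q → (+ 0 ∷ p) *ᵖ q ≋ + 0 ∷ p *ᵖ q
0∷-*ᵖ p q zero = trans (coeff-*ᵖ-zero (+ 0 ∷ p) q) (ℤP.*-zeroˡ (coeffᵖ q 0))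
0∷-*ᵖ p q (suc j) =
  trans (coeff-*ᵖ-suc (+ 0 ∷ p) q j)
        (trans (cong (ℤ._+ coeffᵖ (p *ᵖ q) j) (ℤP.*-zeroˡ (coeffᵖ q (suc j))))
               (ℤP.+-identityˡ (coeffᵖ (p *ᵖ q) j)))

*ᵖ-assoc : ∀ p q r → (p *ᵖ q) *ᵖ r ≋ p *ᵖ (q *ᵖ r)
*ᵖ-assoc [] q r j = refl
*ᵖ-assoc (a ∷ p) q r = begin
  (a ·ᵖ q +ᵖ (+ 0 ∷ p *ᵖ q)) *ᵖ r          ≈⟨ *ᵖ-distribʳ r (a ·ᵖ q) (+ 0 ∷ p *ᵖ q) ⟩
  (a ·ᵖ q) *ᵖ r +ᵖ (+ 0 ∷ p *ᵖ q) *ᵖ r     ≈⟨ +ᵖ-cong {(a ·ᵖ q) *ᵖ r} {a ·ᵖ (q *ᵖ r)} {(+ 0 ∷ p *ᵖ q) *ᵖ r} (·ᵖ-*ᵖ-assoc a q r) (0∷-*ᵖ (p *ᵖ q) r) ⟩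
  a ·ᵖ (q *ᵖ r) +ᵖ (+ 0 ∷ (p *ᵖ q) *ᵖ r)   ≈⟨ +ᵖ-cong {a ·ᵖ (q *ᵖ r)} {a ·ᵖ (q *ᵖ r)} {+ 0 ∷ (p *ᵖ q) *ᵖ r} (λ j → refl) (∷-cong (+ 0) (*ᵖ-assoc p q r)) ⟩
  a ·ᵖ (q *ᵖ r) +ᵖ (+ 0 ∷ p *ᵖ (q *ᵖ r))   ∎
  where open ≋-Reasoning

1ᵖ : ℤPoly
1ᵖ = + 1 ∷ []

*ᵖ-identityˡ : ∀ p → 1ᵖ *ᵖ p ≋ p
*ᵖ-identityˡ p zero = trans (coeff-*ᵖ-zero 1ᵖ p) (ℤP.*-identityˡ (coeffᵖ p 0))
*ᵖ-identityˡ p (suc j) =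
  trans (coeff-*ᵖ-suc 1ᵖ p j)
        (trans (ℤP.+-identityʳ (+ 1 ℤ.* coeffᵖ p (suc j))) (ℤP.*-identityˡ (coeffᵖ p (suc j))))

ℤPoly-isCommutativeSemiringˡ : IsCommutativeSemiringˡ _≋_ _+ᵖ_ _*ᵖ_ [] 1ᵖ
ℤPoly-isCommutativeSemiringˡ = record
  { +-isCommutativeMonoid = record
    { isMonoid = record
      { isSemigroup = record
        { isMagma = record { isEquivalence = ≋-isEquivalence ; ∙-cong = λ {p} {p′} {q} {q′} → +ᵖ-cong {p} {p′} {q} {q′} }
        ; assoc = +ᵖ-assoc
        }
      ; identity = (λ p j → refl) , +ᵖ-identityʳ
      }
    ; comm = +ᵖ-comm
    }
  ; *-isCommutativeMonoid = record
    { isMonoid = record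
      { isSemigroup = record
        { isMagma = record { isEquivalence = ≋-isEquivalence ; ∙-cong = λ {p} {p′} {q} {q′} → *ᵖ-cong {p} {p′} {q} {q′} }
        ; assoc = *ᵖ-assoc
        }
      ; identity = *ᵖ-identityˡ , (λ p j → trans (*ᵖ-comm p 1ᵖ j) (*ᵖ-identityˡ p j))
      }
    ; comm = *ᵖ-comm
    }
  ; distribʳ = *ᵖ-distribʳ
  ; zeroˡ = λ p j → refl
  }

ℤPoly-commutativeSemiring : CommutativeSemiring _ _
ℤPoly-commutativeSemiring = record
  { isCommutativeSemiring = IsCommutativeSemiringˡ.isCommutativeSemiring ℤPoly-isCommutativeSemiringˡ }

open import Algebra.Definitions.RawSemiring (CommutativeSemiring.rawSemiring ℤPoly-commutativeSemiring)
  using () renaming (_^_ to _^ᵖ_; _×_ to _×ᵖ_; sum to ∑ᵖ)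
import Algebra.Properties.CommutativeSemiring.Binomial ℤPoly-commutativeSemiring as Binomial
import Algebra.Properties.CommutativeSemiring.Exp ℤPoly-commutativeSemiring as Exp
import Algebra.Properties.Semiring.Exp (CommutativeSemiring.semiring ℤPoly-commutativeSemiring) as SemiringExp
import Algebra.Properties.Semiring.Sum (CommutativeSemiring.semiring ℤPoly-commutativeSemiring) as Sum
import Algebra.Solver.Ring.NaturalCoefficients.Default ℤPoly-commutativeSemiring as ℤPolySolver

const : ℤ → ℤPoly
const c = c ∷ []

X : ℤPoly
X = + 0 ∷ + 1 ∷ []

coeff-const-*ᵖ : ∀ c p j → coeffᵖ (const c *ᵖ p) j ≡ c ℤ.* coeffᵖ p j
coeff-const-*ᵖ c p zero = coeff-*ᵖ-zero (const c) p
coeff-const-*ᵖ c p (suc j) = trans (coeff-*ᵖ-suc (const c) p j) (ℤP.+-identityʳ (c ℤ.* coeffᵖ p (suc j)))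

coeff-*ᵖ-const : ∀ p c j → coeffᵖ (p *ᵖ const c) j ≡ c ℤ.* coeffᵖ p j
coeff-*ᵖ-const p c j = trans (*ᵖ-comm p (const c) j) (coeff-const-*ᵖ c p j)

const-+ : ∀ a b → const (a ℤ.+ b) ≋ const a +ᵖ const b
const-+ a b zero = refl
const-+ a b (suc j) = refl

const-* : ∀ a b → const (a ℤ.* b) ≋ const a *ᵖ const b
const-* a b zero = sym (coeff-const-*ᵖ a (const b) 0)
const-* a b (suc j) = sym (trans (coeff-const-*ᵖ a (const b) (suc j)) (ℤP.*-zeroʳ a))

const-^ : ∀ c r → const c ^ᵖ r ≋ const (c ℤ.^ r)
const-^ c zero j = refl
const-^ c (suc r) j =
  trans (*ᵖ-congʳ (const c) {const c ^ᵖ r} {const (c ℤ.^ r)} (const-^ c r) j) (sym (const-* c (c ℤ.^ r) j))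

coeff-X*ᵖ-zero : ∀ p → coeffᵖ (X *ᵖ p) 0 ≡ + 0
coeff-X*ᵖ-zero p = trans (coeff-*ᵖ-zero X p) (ℤP.*-zeroˡ (coeffᵖ p 0))

coeff-X*ᵖ-suc : ∀ p j → coeffᵖ (X *ᵖ p) (suc j) ≡ coeffᵖ p j
coeff-X*ᵖ-suc p j =
  trans (coeff-*ᵖ-suc X p j)
        (trans (cong (ℤ._+ coeffᵖ (1ᵖ *ᵖ p) j) (ℤP.*-zeroˡ (coeffᵖ p (suc j))))
               (trans (ℤP.+-identityˡ (coeffᵖ (1ᵖ *ᵖ p) j)) (*ᵖ-identityˡ p j)))

coeff-X^*ᵖ-shift : ∀ j p i → coeffᵖ (X ^ᵖ j *ᵖ p) (j + i) ≡ coeffᵖ p i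
coeff-X^*ᵖ-shift zero p i = *ᵖ-identityˡ p i
coeff-X^*ᵖ-shift (suc j) p i =
  trans (*ᵖ-assoc X (X ^ᵖ j) p (suc (j + i)))
        (trans (coeff-X*ᵖ-suc (X ^ᵖ j *ᵖ p) (j + i)) (coeff-X^*ᵖ-shift j p i))

coeff-X^*ᵖ-below : ∀ j p k → k < j → coeffᵖ (X ^ᵖ j *ᵖ p) k ≡ + 0
coeff-X^*ᵖ-below (suc j) p zero _ =
  trans (*ᵖ-assoc X (X ^ᵖ j) p 0) (coeff-X*ᵖ-zero (X ^ᵖ j *ᵖ p))
coeff-X^*ᵖ-below (suc j) p (suc k) (s≤s k<j) =
  trans (*ᵖ-assoc X (X ^ᵖ j) p (suc k))
        (trans (coeff-X*ᵖ-suc (X ^ᵖ j *ᵖ p) k) (coeff-X^*ᵖ-below j p k k<j))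

coeff-×ᵖ : ∀ c p j → coeffᵖ (c ×ᵖ p) j ≡ + c ℤ.* coeffᵖ p j
coeff-×ᵖ zero p j = sym (ℤP.*-zeroˡ (coeffᵖ p j))
coeff-×ᵖ (suc c) p j = begin
  coeffᵖ (p +ᵖ c ×ᵖ p) j                   ≡⟨ coeff-+ᵖ p (c ×ᵖ p) j ⟩
  coeffᵖ p j ℤ.+ coeffᵖ (c ×ᵖ p) j          ≡⟨ cong (ℤ._+_ (coeffᵖ p j)) (coeff-×ᵖ c p j) ⟩
  coeffᵖ p j ℤ.+ + c ℤ.* coeffᵖ p j         ≡⟨ add-one-more (+ c) (coeffᵖ p j) ⟩
  (+ 1 ℤ.+ + c) ℤ.* coeffᵖ p j              ≡⟨ cong (ℤ._* coeffᵖ p j) (ℤP.pos-+ 1 c) ⟨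
  + suc c ℤ.* coeffᵖ p j                    ∎
  where
  open ≡-Reasoning
  add-one-more : ∀ c x → x ℤ.+ c ℤ.* x ≡ (+ 1 ℤ.+ c) ℤ.* x
  add-one-more = solve-∀

∑ᵖ-toℕ : ∀ n (G : ℕ → ℤPoly) → ∑ᵖ {n} (G ∘ toℕ) ≡ ⨁< _+ᵖ_ [] n G
∑ᵖ-toℕ zero G = refl
∑ᵖ-toℕ (suc n) G = cong (G 0 +ᵖ_) (∑ᵖ-toℕ n (G ∘ suc))

coeff-∑ᵖ : ∀ n (G : ℕ → ℤPoly) j → coeffᵖ (∑ᵖ {n} (G ∘ toℕ)) j ≡ ∑ℤ< n (λ l → coeffᵖ (G l) j)
coeff-∑ᵖ n G j =
  trans (cong (λ p → coeffᵖ p j) (∑ᵖ-toℕ n G)) (⨁<-hom (λ p → coeffᵖ p j) refl (λ p q → coeff-+ᵖ p q j) n G)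

coeff-binomial-const : ∀ n x c k →
  coeffᵖ ((x +ᵖ const c) ^ᵖ n) k
    ≡ ∑ℤ< (suc n) (λ i → + (n C i) ℤ.* (c ℤ.^ (n ∸ i) ℤ.* coeffᵖ (x ^ᵖ i) k))
coeff-binomial-const n x c k = begin
  coeffᵖ ((x +ᵖ const c) ^ᵖ n) k                     ≡⟨ Binomial.theorem n x (const c) k ⟩
  coeffᵖ (Binomial.binomialExpansion x (const c) n) k ≡⟨ coeff-∑ᵖ (suc n) term k ⟩
  ∑ℤ< (suc n) (λ i → coeffᵖ (term i) k)             ≡⟨ ⨁<-cong ℤ._+_ (+ 0) (suc n) coeff-term ⟩
  ∑ℤ< (suc n) (λ i → + (n C i) ℤ.* (c ℤ.^ (n ∸ i) ℤ.* coeffᵖ (x ^ᵖ i) k)) ∎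
  where
  open ≡-Reasoning
  term : ℕ → ℤPoly
  term i = (n C i) ×ᵖ (x ^ᵖ i *ᵖ const c ^ᵖ (n ∸ i))
  coeff-term : ∀ i → coeffᵖ (term i) k ≡ + (n C i) ℤ.* (c ℤ.^ (n ∸ i) ℤ.* coeffᵖ (x ^ᵖ i) k)
  coeff-term i =
    trans (coeff-×ᵖ (n C i) (x ^ᵖ i *ᵖ const c ^ᵖ (n ∸ i)) k)
          (cong (+ (n C i) ℤ.*_)
                (trans (*ᵖ-congʳ (x ^ᵖ i) {const c ^ᵖ (n ∸ i)} {const (c ℤ.^ (n ∸ i))} (const-^ c (n ∸ i)) k)
                       (coeff-*ᵖ-const (x ^ᵖ i) (c ℤ.^ (n ∸ i)) k)))

-- Evaluating natural-number polynomials

infix 9 _⟨_⟩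

_⟨_⟩ : Poly → ℤPoly → ℤPoly
[] ⟨ Y ⟩ = []
(a ∷ q) ⟨ Y ⟩ = const (+ a) +ᵖ Y *ᵖ q ⟨ Y ⟩

module _ (Y : ℤPoly) where
  open ≋-Reasoning
  open ℤPolySolver using (solve; _:+_; _:*_; _:=_; con)

  eval-addP : ∀ p q → (addP p q) ⟨ Y ⟩ ≋ p ⟨ Y ⟩ +ᵖ q ⟨ Y ⟩
  eval-addP [] q j = refl
  eval-addP (a ∷ p) [] j = sym (+ᵖ-identityʳ ((a ∷ p) ⟨ Y ⟩) j)
  eval-addP (a ∷ p) (b ∷ q) = begin
    const (+ (a + b)) +ᵖ Y *ᵖ (addP p q) ⟨ Y ⟩
      ≈⟨ +ᵖ-cong {const (+ (a + b))} {const (+ a) +ᵖ const (+ b)} {Y *ᵖ (addP p q) ⟨ Y ⟩} {Y *ᵖ (p ⟨ Y ⟩ +ᵖ q ⟨ Y ⟩)}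
                 (λ j → trans (cong (λ c → coeffᵖ (const c) j) (ℤP.pos-+ a b)) (const-+ (+ a) (+ b) j))
                 (*ᵖ-congʳ Y {(addP p q) ⟨ Y ⟩} {p ⟨ Y ⟩ +ᵖ q ⟨ Y ⟩} (eval-addP p q)) ⟩
    (const (+ a) +ᵖ const (+ b)) +ᵖ Y *ᵖ (p ⟨ Y ⟩ +ᵖ q ⟨ Y ⟩)
      ≈⟨ solve 5 (λ A B y P Q → (A :+ B) :+ y :* (P :+ Q) := (A :+ y :* P) :+ (B :+ y :* Q)) (λ _ → refl)
               (const (+ a)) (const (+ b)) Y (p ⟨ Y ⟩) (q ⟨ Y ⟩) ⟩
    (a ∷ p) ⟨ Y ⟩ +ᵖ (b ∷ q) ⟨ Y ⟩ ∎

  eval-scaleP : ∀ c q → (scaleP c q) ⟨ Y ⟩ ≋ const (+ c) *ᵖ q ⟨ Y ⟩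
  eval-scaleP c [] j = sym (*ᵖ-comm (const (+ c)) [] j)
  eval-scaleP c (a ∷ q) = begin
    const (+ (c * a)) +ᵖ Y *ᵖ (scaleP c q) ⟨ Y ⟩
      ≈⟨ +ᵖ-cong {const (+ (c * a))} {const (+ c) *ᵖ const (+ a)} {Y *ᵖ (scaleP c q) ⟨ Y ⟩} {Y *ᵖ (const (+ c) *ᵖ q ⟨ Y ⟩)}
                 (λ j → trans (cong (λ d → coeffᵖ (const d) j) (ℤP.pos-* c a)) (const-* (+ c) (+ a) j))
                 (*ᵖ-congʳ Y {(scaleP c q) ⟨ Y ⟩} {const (+ c) *ᵖ q ⟨ Y ⟩} (eval-scaleP c q)) ⟩
    const (+ c) *ᵖ const (+ a) +ᵖ Y *ᵖ (const (+ c) *ᵖ q ⟨ Y ⟩)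
      ≈⟨ solve 4 (λ C A y Q → C :* A :+ y :* (C :* Q) := C :* (A :+ y :* Q)) (λ _ → refl)
               (const (+ c)) (const (+ a)) Y (q ⟨ Y ⟩) ⟩
    const (+ c) *ᵖ (a ∷ q) ⟨ Y ⟩ ∎

  eval-mulP : ∀ p q → (mulP p q) ⟨ Y ⟩ ≋ p ⟨ Y ⟩ *ᵖ q ⟨ Y ⟩
  eval-mulP [] q j = refl
  eval-mulP (a ∷ p) q = begin
    (addP (scaleP a q) (0 ∷ mulP p q)) ⟨ Y ⟩
      ≈⟨ eval-addP (scaleP a q) (0 ∷ mulP p q) ⟩
    (scaleP a q) ⟨ Y ⟩ +ᵖ (const (+ 0) +ᵖ Y *ᵖ (mulP p q) ⟨ Y ⟩)
      ≈⟨ +ᵖ-cong {(scaleP a q) ⟨ Y ⟩} {const (+ a) *ᵖ q ⟨ Y ⟩} {const (+ 0) +ᵖ Y *ᵖ (mulP p q) ⟨ Y ⟩} {[] +ᵖ Y *ᵖ (p ⟨ Y ⟩ *ᵖ q ⟨ Y ⟩)}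
                 (eval-scaleP a q)
                 (+ᵖ-cong {const (+ 0)} {[]} {Y *ᵖ (mulP p q) ⟨ Y ⟩} {Y *ᵖ (p ⟨ Y ⟩ *ᵖ q ⟨ Y ⟩)} const-0
                          (*ᵖ-congʳ Y {(mulP p q) ⟨ Y ⟩} {p ⟨ Y ⟩ *ᵖ q ⟨ Y ⟩} (eval-mulP p q))) ⟩
    const (+ a) *ᵖ q ⟨ Y ⟩ +ᵖ ([] +ᵖ Y *ᵖ (p ⟨ Y ⟩ *ᵖ q ⟨ Y ⟩))
      ≈⟨ solve 4 (λ A Q y P → A :* Q :+ (con 0 :+ y :* (P :* Q)) := (A :+ y :* P) :* Q) (λ _ → refl)
               (const (+ a)) (q ⟨ Y ⟩) Y (p ⟨ Y ⟩) ⟩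
    (a ∷ p) ⟨ Y ⟩ *ᵖ q ⟨ Y ⟩ ∎
    where
    const-0 : const (+ 0) ≋ []
    const-0 zero = refl
    const-0 (suc j) = refl

  eval-one : (1 ∷ []) ⟨ Y ⟩ ≋ 1ᵖ
  eval-one j =
    trans (coeff-+ᵖ 1ᵖ (Y *ᵖ []) j)
          (trans (cong (ℤ._+_ (coeffᵖ 1ᵖ j)) (*ᵖ-comm Y [] j)) (ℤP.+-identityʳ (coeffᵖ 1ᵖ j)))

  eval-powP : ∀ p n → (powP p n) ⟨ Y ⟩ ≋ p ⟨ Y ⟩ ^ᵖ n
  eval-powP p zero = eval-one
  eval-powP p (suc n) =
    λ j → trans (eval-mulP p (powP p n) j) (*ᵖ-congʳ (p ⟨ Y ⟩) {(powP p n) ⟨ Y ⟩} {p ⟨ Y ⟩ ^ᵖ n} (eval-powP p n) j)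

  eval-as-∑ : ∀ q → q ⟨ Y ⟩ ≋ ∑ᵖ {length q} (λ l → const (+ coeff q (toℕ l)) *ᵖ Y ^ᵖ toℕ l)
  eval-as-∑ [] j = refl
  eval-as-∑ (a ∷ q) = begin
    const (+ a) +ᵖ Y *ᵖ q ⟨ Y ⟩
      ≈⟨ +ᵖ-cong {const (+ a)} {const (+ a) *ᵖ 1ᵖ} {Y *ᵖ q ⟨ Y ⟩} {Y *ᵖ ∑ᵖ {length q} T}
                 (λ j → sym (trans (*ᵖ-comm (const (+ a)) 1ᵖ j) (*ᵖ-identityˡ (const (+ a)) j)))
                 (*ᵖ-congʳ Y {q ⟨ Y ⟩} {∑ᵖ {length q} T} (eval-as-∑ q)) ⟩
    const (+ a) *ᵖ 1ᵖ +ᵖ Y *ᵖ ∑ᵖ {length q} T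
      ≈⟨ +ᵖ-cong {const (+ a) *ᵖ 1ᵖ} {const (+ a) *ᵖ 1ᵖ} {Y *ᵖ ∑ᵖ {length q} T} {∑ᵖ {length q} (λ l → Y *ᵖ T l)}
                 (λ j → refl) (Sum.*-distribˡ-sum Y T) ⟩
    const (+ a) *ᵖ 1ᵖ +ᵖ ∑ᵖ {length q} (λ l → Y *ᵖ T l)
      ≈⟨ +ᵖ-cong {const (+ a) *ᵖ 1ᵖ} {const (+ a) *ᵖ 1ᵖ} {∑ᵖ {length q} (λ l → Y *ᵖ T l)}
                 {∑ᵖ {length q} (λ l → const (+ coeff q (toℕ l)) *ᵖ (Y *ᵖ Y ^ᵖ toℕ l))}
                 (λ j → refl)
                 (Sum.sum-cong-≋ {length q} {λ l → Y *ᵖ T l} {λ l → const (+ coeff q (toℕ l)) *ᵖ (Y *ᵖ Y ^ᵖ toℕ l)} (λ l → solve 3 (λ y c v → y :* (c :* v) := c :* (y :* v)) (λ _ → refl)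
                                                Y (const (+ coeff q (toℕ l))) (Y ^ᵖ toℕ l))) ⟩
    ∑ᵖ {length (a ∷ q)} (λ l → const (+ coeff (a ∷ q) (toℕ l)) *ᵖ Y ^ᵖ toℕ l) ∎
    where
    T : Fin (length q) → ℤPoly
    T l = const (+ coeff q (toℕ l)) *ᵖ Y ^ᵖ toℕ l

coeff-⟨X⟩ : ∀ q j → coeffᵖ (q ⟨ X ⟩) j ≡ + coeff q j
coeff-⟨X⟩ [] j = refl
coeff-⟨X⟩ (a ∷ q) zero =
  trans (coeff-+ᵖ (const (+ a)) (X *ᵖ q ⟨ X ⟩) 0)
        (trans (cong (ℤ._+_ (+ a)) (coeff-X*ᵖ-zero (q ⟨ X ⟩))) (ℤP.+-identityʳ (+ a)))
coeff-⟨X⟩ (a ∷ q) (suc j) =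
  trans (coeff-+ᵖ (const (+ a)) (X *ᵖ q ⟨ X ⟩) (suc j))
        (trans (ℤP.+-identityˡ (coeffᵖ (X *ᵖ q ⟨ X ⟩) (suc j)))
               (trans (coeff-X*ᵖ-suc (q ⟨ X ⟩) j) (coeff-⟨X⟩ q j)))

U : ℤPoly
U = 1ᵖ +ᵖ X

coeff-U^ : ∀ N i → coeffᵖ (U ^ᵖ N) i ≡ + (N C i)
coeff-U^ zero zero = refl
coeff-U^ zero (suc i) = refl
coeff-U^ (suc N) i =
  trans (*ᵖ-distribʳ (U ^ᵖ N) 1ᵖ X i)
        (trans (coeff-+ᵖ (1ᵖ *ᵖ U ^ᵖ N) (X *ᵖ U ^ᵖ N) i)
               (trans (cong (ℤ._+ coeffᵖ (X *ᵖ U ^ᵖ N) i) (trans (*ᵖ-identityˡ (U ^ᵖ N) i) (coeff-U^ N i)))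
                      (pascal i)))
  where
  pascal : ∀ i → + (N C i) ℤ.+ coeffᵖ (X *ᵖ U ^ᵖ N) i ≡ + (suc N C i)
  pascal zero = cong (ℤ._+_ (+ (N C 0))) (coeff-X*ᵖ-zero (U ^ᵖ N))
  pascal (suc i) = begin
    + (N C suc i) ℤ.+ coeffᵖ (X *ᵖ U ^ᵖ N) (suc i) ≡⟨ cong (ℤ._+_ (+ (N C suc i))) (coeff-X*ᵖ-suc (U ^ᵖ N) i) ⟩
    + (N C suc i) ℤ.+ coeffᵖ (U ^ᵖ N) i            ≡⟨ cong (ℤ._+_ (+ (N C suc i))) (coeff-U^ N i) ⟩
    + (N C suc i) ℤ.+ + (N C i)                    ≡⟨ ℤP.pos-+ (N C suc i) (N C i) ⟨
    + (N C suc i + N C i)                          ≡⟨ cong +_ (ℕP.+-comm (N C suc i) (N C i)) ⟩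
    + (N C i + N C suc i)                          ≡⟨ cong +_ (nCk+nC[k+1]≡[n+1]C[k+1] N i) ⟩
    + (suc N C suc i)                              ∎
    where open ≡-Reasoning

coeff-⟨U⟩ : ∀ q k → coeffᵖ (q ⟨ U ⟩) k ≡ ∑ℤ< (length q) (λ l → + coeff q l ℤ.* + (l C k))
coeff-⟨U⟩ q k =
  trans (eval-as-∑ U q k)
        (trans (coeff-∑ᵖ (length q) (λ l → const (+ coeff q l) *ᵖ U ^ᵖ l) k)
               (⨁<-cong ℤ._+_ (+ 0) (length q)
                  (λ l → trans (coeff-const-*ᵖ (+ coeff q l) (U ^ᵖ l) k) (cong (+ coeff q l ℤ.*_) (coeff-U^ l k)))))

geometric-sum : ∀ m → X *ᵖ (pr m) ⟨ U ⟩ +ᵖ 1ᵖ ≋ U ^ᵖ suc m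
geometric-sum zero = begin
  X *ᵖ (1 ∷ []) ⟨ U ⟩ +ᵖ 1ᵖ
    ≈⟨ +ᵖ-cong {X *ᵖ (1 ∷ []) ⟨ U ⟩} {X *ᵖ 1ᵖ} {1ᵖ} {1ᵖ} (*ᵖ-congʳ X {(1 ∷ []) ⟨ U ⟩} {1ᵖ} (eval-one U)) (λ j → refl) ⟩
  X *ᵖ 1ᵖ +ᵖ 1ᵖ
    ≈⟨ solve 1 (λ x → x :* con 1 :+ con 1 := (con 1 :+ x) :* con 1) (λ _ → refl) X ⟩
  U ^ᵖ 1 ∎
  where
  open ≋-Reasoning
  open ℤPolySolver using (solve; _:+_; _:*_; _:=_; con)
geometric-sum (suc m) = begin
  X *ᵖ (1ᵖ +ᵖ U *ᵖ P) +ᵖ 1ᵖ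
    ≈⟨ solve 2 (λ x p → x :* (con 1 :+ (con 1 :+ x) :* p) :+ con 1 := (con 1 :+ x) :* (x :* p :+ con 1))
             (λ _ → refl) X P ⟩
  U *ᵖ (X *ᵖ P +ᵖ 1ᵖ)
    ≈⟨ *ᵖ-congʳ U {X *ᵖ P +ᵖ 1ᵖ} {U ^ᵖ suc m} (geometric-sum m) ⟩
  U ^ᵖ suc (suc m) ∎
  where
  open ≋-Reasoning
  open ℤPolySolver using (solve; _:+_; _:*_; _:=_; con)
  P = (pr m) ⟨ U ⟩

X*pr⟨U⟩ : ∀ m → X *ᵖ (pr m) ⟨ U ⟩ ≋ U ^ᵖ suc m +ᵖ const (ℤ.- + 1)
X*pr⟨U⟩ m = begin
  XP                                  ≈⟨ (λ j → sym (+ᵖ-identityʳ XP j)) ⟩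
  XP +ᵖ []                            ≈⟨ +ᵖ-cong {XP} {XP} {[]} {1ᵖ +ᵖ const (ℤ.- + 1)} (λ j → refl) one-minus-one ⟩
  XP +ᵖ (1ᵖ +ᵖ const (ℤ.- + 1))      ≈⟨ +ᵖ-assoc XP 1ᵖ (const (ℤ.- + 1)) ⟨
  XP +ᵖ 1ᵖ +ᵖ const (ℤ.- + 1)        ≈⟨ +ᵖ-cong {XP +ᵖ 1ᵖ} {U ^ᵖ suc m} {const (ℤ.- + 1)} {const (ℤ.- + 1)}
                                           (geometric-sum m) (λ j → refl) ⟩
  U ^ᵖ suc m +ᵖ const (ℤ.- + 1)      ∎
  where
  open ≋-Reasoning
  XP = X *ᵖ (pr m) ⟨ U ⟩
  one-minus-one : [] ≋ 1ᵖ +ᵖ const (ℤ.- + 1)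
  one-minus-one zero = refl
  one-minus-one (suc j) = refl

coeff-≥length : ∀ p j → length p ≤ j → coeff p j ≡ 0
coeff-≥length [] j _ = refl
coeff-≥length (a ∷ p) (suc j) (s≤s len≤j) = coeff-≥length p j len≤j

length-addP : ∀ p q → length (addP p q) ≡ length p ⊔ length q
length-addP [] q = refl
length-addP (a ∷ p) [] = refl
length-addP (a ∷ p) (b ∷ q) = cong suc (length-addP p q)

length-mulP : ∀ a p b q → length (mulP (a ∷ p) (b ∷ q)) ≡ suc (length p + length q)
length-mulP a [] b q =
  trans (length-addP (scaleP a (b ∷ q)) (0 ∷ []))
        (cong suc (trans (cong (_⊔ 0) (length-map (a *_) q)) (ℕP.⊔-identityʳ (length q))))
length-mulP a (c ∷ p) b q =
  trans (length-addP (scaleP a (b ∷ q)) (0 ∷ mulP (c ∷ p) (b ∷ q)))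
        (trans (cong₂ _⊔_ (cong suc (length-map (a *_) q)) (cong suc (length-mulP c p b q)))
               (ℕP.m≤n⇒m⊔n≡n (s≤s (ℕP.≤-trans (ℕP.m≤n+m (length q) (length p)) (ℕP.n≤1+n _)))))

length-powP-pr : ∀ m n → length (powP (pr m) n) ≡ suc (m * n)
length-powP-pr m zero = cong suc (sym (ℕP.*-zeroʳ m))
length-powP-pr m (suc n) with powP (pr m) n | length-powP-pr m n
... | b ∷ q | len = begin
  length (mulP (1 ∷ replicate m 1) (b ∷ q)) ≡⟨ length-mulP 1 (replicate m 1) b q ⟩
  suc (length (replicate m 1) + length q)    ≡⟨ cong₂ (λ x y → suc (x + y)) (length-replicate m) (ℕP.suc-injective len) ⟩
  suc (m + m * n)                            ≡⟨ cong suc (ℕP.*-suc m n) ⟨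
  suc (m * suc n)                            ∎
  where open ≡-Reasoning

binomR-vanish : ∀ m N k → m * N < k → binomR m N k ≡ 0
binomR-vanish m N k mN<k = coeff-≥length (powP (pr m) N) k (subst (_≤ k) (sym (length-powP-pr m N)) mN<k)

<ceilDiv⇒*< : ∀ m k l → l < ceilDiv k (suc m) → suc m * l < k
<ceilDiv⇒*< m k l l<⌈k/m⌉ = ℕP.+-cancelʳ-≤ m (suc (suc m * l)) k (begin
  suc (suc m * l) + m            ≡⟨ rearrange m l ⟩
  suc l * suc m                  ≤⟨ ℕP.*-monoˡ-≤ (suc m) l<⌈k/m⌉ ⟩
  ceilDiv k (suc m) * suc m      ≤⟨ m/n*n≤m (k + m) (suc m) ⟩
  k + m                          ∎)
  where
  open ℕP.≤-Reasoning
  rearrange : ∀ m l → suc (suc m * l) + m ≡ suc l * suc m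
  rearrange = ℕSolver.solve-∀

binomRℤ-⊖ : ∀ r N k j → k < j → binomRℤ r N (k ℤ.⊖ j) ≡ 0
binomRℤ-⊖ r N zero (suc j) _ = refl
binomRℤ-⊖ r N (suc k) (suc j) (s≤s k<j) =
  trans (cong (binomRℤ r N) (ℤP.[1+m]⊖[1+n]≡m⊖n k j)) (binomRℤ-⊖ r N k j k<j)

coeff-X^*ᵖ-powP-pr : ∀ r N j k →
  coeffᵖ (X ^ᵖ j *ᵖ (powP (pr r) N) ⟨ X ⟩) k ≡ + binomRℤ r N (+ k ℤ.- + j)
coeff-X^*ᵖ-powP-pr r N j k with j ℕP.≤? k
... | yes j≤k = begin
  coeffᵖ (X ^ᵖ j *ᵖ A) k               ≡⟨ cong (coeffᵖ (X ^ᵖ j *ᵖ A)) (ℕP.m+[n∸m]≡n j≤k) ⟨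
  coeffᵖ (X ^ᵖ j *ᵖ A) (j + (k ∸ j))   ≡⟨ coeff-X^*ᵖ-shift j A (k ∸ j) ⟩
  coeffᵖ A (k ∸ j)                     ≡⟨ coeff-⟨X⟩ (powP (pr r) N) (k ∸ j) ⟩
  + binomR r N (k ∸ j)                 ≡⟨ cong (+_ ∘ binomRℤ r N) (trans (ℤP.m-n≡m⊖n k j) (ℤP.⊖-≥ j≤k)) ⟨
  + binomRℤ r N (+ k ℤ.- + j)          ∎
  where
  open ≡-Reasoning
  A = (powP (pr r) N) ⟨ X ⟩
... | no j≰k =
  trans (coeff-X^*ᵖ-below j ((powP (pr r) N) ⟨ X ⟩) k (ℕP.≰⇒> j≰k))
        (cong +_ (sym (trans (cong (binomRℤ r N) (ℤP.m-n≡m⊖n k j)) (binomRℤ-⊖ r N k j (ℕP.≰⇒> j≰k)))))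

-- The two identities

pos-^ : ∀ a r → + (a ^ r) ≡ (+ a) ℤ.^ r
pos-^ a zero = refl
pos-^ a (suc r) = trans (ℤP.pos-* a (a ^ r)) (cong (+ a ℤ.*_) (pos-^ a r))

coeff-⟨X⟩^ : ∀ p l k → coeffᵖ ((p ⟨ X ⟩) ^ᵖ l) k ≡ + coeff (powP p l) k
coeff-⟨X⟩^ p l k = trans (sym (eval-powP X p l k)) (coeff-⟨X⟩ (powP p l) k)

coeff-[X*pr⟨X⟩]^ : ∀ r j k → coeffᵖ ((X *ᵖ (pr r) ⟨ X ⟩) ^ᵖ j) k ≡ + binomRℤ r j (+ k ℤ.- + j)
coeff-[X*pr⟨X⟩]^ r j k = begin
  coeffᵖ ((X *ᵖ B) ^ᵖ j) k                    ≡⟨ Exp.^-distrib-* X B j k ⟩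
  coeffᵖ (X ^ᵖ j *ᵖ B ^ᵖ j) k                 ≡⟨ *ᵖ-congʳ (X ^ᵖ j) {B ^ᵖ j} {(powP (pr r) j) ⟨ X ⟩}
                                                    (λ i → sym (eval-powP X (pr r) j i)) k ⟩
  coeffᵖ (X ^ᵖ j *ᵖ (powP (pr r) j) ⟨ X ⟩) k  ≡⟨ coeff-X^*ᵖ-powP-pr r j j k ⟩
  + binomRℤ r j (+ k ℤ.- + j)                 ∎
  where
  open ≡-Reasoning
  B = (pr r) ⟨ X ⟩

pr-suc⟨X⟩+1 : ∀ m → (pr (suc m)) ⟨ X ⟩ +ᵖ const (+ 1) ≋ X *ᵖ (pr m) ⟨ X ⟩ +ᵖ const (+ 2)
pr-suc⟨X⟩+1 m = begin
  1ᵖ +ᵖ XB +ᵖ 1ᵖ          ≈⟨ solve 1 (λ x → con 1 :+ x :+ con 1 := x :+ (con 1 :+ con 1)) (λ _ → refl) XB ⟩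
  XB +ᵖ (1ᵖ +ᵖ 1ᵖ)        ≈⟨ +ᵖ-cong {XB} {XB} {1ᵖ +ᵖ 1ᵖ} {const (+ 2)} (λ j → refl) (λ j → sym (const-+ (+ 1) (+ 1) j)) ⟩
  XB +ᵖ const (+ 2)       ∎
  where
  open ≋-Reasoning
  open ℤPolySolver using (solve; _:+_; _:=_; con)
  XB = X *ᵖ (pr m) ⟨ X ⟩

sum-C-binomR-ℤ : ∀ m n k →
  ∑ℤ< (suc n) (λ l → + ((n C l) * binomR (suc m) l k))
    ≡ ∑ℤ< (suc n) (λ j → + (2 ^ (n ∸ j) * (n C j) * binomRℤ m j (+ k ℤ.- + j)))
sum-C-binomR-ℤ m n k = begin
  ∑ℤ< (suc n) (λ l → + ((n C l) * binomR (suc m) l k))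
    ≡⟨ ⨁<-cong ℤ._+_ (+ 0) (suc n) left-term ⟩
  ∑ℤ< (suc n) (λ l → + (n C l) ℤ.* ((+ 1) ℤ.^ (n ∸ l) ℤ.* coeffᵖ (P ^ᵖ l) k))
    ≡⟨ coeff-binomial-const n P (+ 1) k ⟨
  coeffᵖ ((P +ᵖ const (+ 1)) ^ᵖ n) k
    ≡⟨ SemiringExp.^-congˡ n {P +ᵖ const (+ 1)} {XB +ᵖ const (+ 2)} (pr-suc⟨X⟩+1 m) k ⟩
  coeffᵖ ((XB +ᵖ const (+ 2)) ^ᵖ n) k
    ≡⟨ coeff-binomial-const n XB (+ 2) k ⟩
  ∑ℤ< (suc n) (λ j → + (n C j) ℤ.* ((+ 2) ℤ.^ (n ∸ j) ℤ.* coeffᵖ (XB ^ᵖ j) k))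
    ≡⟨ ⨁<-cong ℤ._+_ (+ 0) (suc n) right-term ⟩
  ∑ℤ< (suc n) (λ j → + (2 ^ (n ∸ j) * (n C j) * binomRℤ m j (+ k ℤ.- + j))) ∎
  where
  open ≡-Reasoning
  P = (pr (suc m)) ⟨ X ⟩
  XB = X *ᵖ (pr m) ⟨ X ⟩
  left-term : ∀ l → + ((n C l) * binomR (suc m) l k) ≡ + (n C l) ℤ.* ((+ 1) ℤ.^ (n ∸ l) ℤ.* coeffᵖ (P ^ᵖ l) k)
  left-term l = trans (ℤP.pos-* (n C l) (binomR (suc m) l k)) (cong (+ (n C l) ℤ.*_) (sym (begin
    (+ 1) ℤ.^ (n ∸ l) ℤ.* coeffᵖ (P ^ᵖ l) k    ≡⟨ cong (ℤ._* coeffᵖ (P ^ᵖ l) k) (ℤP.^-zeroˡ (n ∸ l)) ⟩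
    + 1 ℤ.* coeffᵖ (P ^ᵖ l) k               ≡⟨ ℤP.*-identityˡ (coeffᵖ (P ^ᵖ l) k) ⟩
    coeffᵖ (P ^ᵖ l) k                       ≡⟨ coeff-⟨X⟩^ (pr (suc m)) l k ⟩
    + binomR (suc m) l k                    ∎)))
  right-term : ∀ j → + (n C j) ℤ.* ((+ 2) ℤ.^ (n ∸ j) ℤ.* coeffᵖ (XB ^ᵖ j) k)
                     ≡ + (2 ^ (n ∸ j) * (n C j) * binomRℤ m j (+ k ℤ.- + j))
  right-term j = begin
    + c ℤ.* ((+ 2) ℤ.^ (n ∸ j) ℤ.* coeffᵖ (XB ^ᵖ j) k)  ≡⟨ cong₂ (λ x y → + c ℤ.* (x ℤ.* y)) (sym (pos-^ 2 (n ∸ j))) (coeff-[X*pr⟨X⟩]^ m j k) ⟩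
    + c ℤ.* (+ (2 ^ (n ∸ j)) ℤ.* + b)                 ≡⟨ reorder (+ c) (+ (2 ^ (n ∸ j))) (+ b) ⟩
    + (2 ^ (n ∸ j)) ℤ.* + c ℤ.* + b                   ≡⟨ cong (ℤ._* + b) (ℤP.pos-* (2 ^ (n ∸ j)) c) ⟨
    + (2 ^ (n ∸ j) * c) ℤ.* + b                       ≡⟨ ℤP.pos-* (2 ^ (n ∸ j) * c) b ⟨
    + (2 ^ (n ∸ j) * c * b)                           ∎
    where
    c = n C j
    b = binomRℤ m j (+ k ℤ.- + j)
    reorder : ∀ c t b → c ℤ.* (t ℤ.* b) ≡ t ℤ.* c ℤ.* b
    reorder = solve-∀

sum-binomR-C-ℤ : ∀ m n k →
  ∑ℤ< (length (powP (pr m) n)) (λ l → + binomR m n l ℤ.* + (l C k))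
    ≡ ∑ℤ< (suc n) (λ j → (ℤ.- + 1) ℤ.^ (n ∸ j) ℤ.* + ((n C j) * (((m + 1) * j) C (k + n))))
sum-binomR-C-ℤ m n k = begin
  ∑ℤ< (length (powP (pr m) n)) (λ l → + binomR m n l ℤ.* + (l C k))
    ≡⟨ coeff-⟨U⟩ (powP (pr m) n) k ⟨
  coeffᵖ ((powP (pr m) n) ⟨ U ⟩) k
    ≡⟨ eval-powP U (pr m) n k ⟩
  coeffᵖ (P ^ᵖ n) k
    ≡⟨ coeff-X^*ᵖ-shift n (P ^ᵖ n) k ⟨
  coeffᵖ (X ^ᵖ n *ᵖ P ^ᵖ n) (n + k)
    ≡⟨ Exp.^-distrib-* X P n (n + k) ⟨
  coeffᵖ ((X *ᵖ P) ^ᵖ n) (n + k)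
    ≡⟨ SemiringExp.^-congˡ n {X *ᵖ P} {U ^ᵖ suc m +ᵖ const (ℤ.- + 1)} (X*pr⟨U⟩ m) (n + k) ⟩
  coeffᵖ ((U ^ᵖ suc m +ᵖ const (ℤ.- + 1)) ^ᵖ n) (n + k)
    ≡⟨ coeff-binomial-const n (U ^ᵖ suc m) (ℤ.- + 1) (n + k) ⟩
  ∑ℤ< (suc n) (λ j → + (n C j) ℤ.* ((ℤ.- + 1) ℤ.^ (n ∸ j) ℤ.* coeffᵖ ((U ^ᵖ suc m) ^ᵖ j) (n + k)))
    ≡⟨ ⨁<-cong ℤ._+_ (+ 0) (suc n) term ⟩
  ∑ℤ< (suc n) (λ j → (ℤ.- + 1) ℤ.^ (n ∸ j) ℤ.* + ((n C j) * (((m + 1) * j) C (k + n)))) ∎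
  where
  open ≡-Reasoning
  P = (pr m) ⟨ U ⟩
  term : ∀ j → + (n C j) ℤ.* ((ℤ.- + 1) ℤ.^ (n ∸ j) ℤ.* coeffᵖ ((U ^ᵖ suc m) ^ᵖ j) (n + k))
               ≡ (ℤ.- + 1) ℤ.^ (n ∸ j) ℤ.* + ((n C j) * (((m + 1) * j) C (k + n)))
  term j = begin
    + c ℤ.* (s ℤ.* coeffᵖ ((U ^ᵖ suc m) ^ᵖ j) (n + k))
      ≡⟨ cong (λ x → + c ℤ.* (s ℤ.* x)) (trans (SemiringExp.^-assocʳ U (suc m) j (n + k)) (coeff-U^ (suc m * j) (n + k))) ⟩
    + c ℤ.* (s ℤ.* + ((suc m * j) C (n + k)))
      ≡⟨ cong₂ (λ a b → + c ℤ.* (s ℤ.* + ((a * j) C b))) (ℕP.+-comm 1 m) (ℕP.+-comm n k) ⟩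
    + c ℤ.* (s ℤ.* + (((m + 1) * j) C (k + n)))
      ≡⟨ reorder (+ c) s (+ (((m + 1) * j) C (k + n))) ⟩
    s ℤ.* (+ c ℤ.* + (((m + 1) * j) C (k + n)))
      ≡⟨ cong (s ℤ.*_) (ℤP.pos-* c (((m + 1) * j) C (k + n))) ⟨
    s ℤ.* + (c * (((m + 1) * j) C (k + n))) ∎
    where
    c = n C j
    s = (ℤ.- + 1) ℤ.^ (n ∸ j)
    reorder : ∀ c s b → c ℤ.* (s ℤ.* b) ≡ s ℤ.* (c ℤ.* b)
    reorder = solve-∀

sum-C-binomR : ∀ m n k →
  Σℕ[ ceilDiv k (suc m) , n ] (λ l → (n C l) * binomR (suc m) l k)
    ≡ Σℕ[ 0 , n ] (λ j → 2 ^ (n ∸ j) * (n C j) * binomRℤ m j (+ k ℤ.- + j))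
sum-C-binomR m n k = ℤP.+-injective (begin
  + Σℕ[ ceilDiv k (suc m) , n ] f  ≡⟨ cong +_ (sumFT≡⨁< _+_ 0 (λ _ → refl) (ceilDiv k (suc m)) n f vanish) ⟩
  + ∑ℕ< (suc n) f                  ≡⟨ pos-∑ℕ< (suc n) f ⟩
  ∑ℤ< (suc n) (+_ ∘ f)             ≡⟨ sum-C-binomR-ℤ m n k ⟩
  ∑ℤ< (suc n) (+_ ∘ g)             ≡⟨ pos-∑ℕ< (suc n) g ⟨
  + ∑ℕ< (suc n) g                  ≡⟨ cong +_ (sumFT≡⨁< _+_ 0 (λ _ → refl) 0 n g (λ _ ())) ⟨
  + Σℕ[ 0 , n ] g                  ∎)
  where
  open ≡-Reasoning
  f = λ l → (n C l) * binomR (suc m) l k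
  g = λ j → 2 ^ (n ∸ j) * (n C j) * binomRℤ m j (+ k ℤ.- + j)
  vanish : ∀ l → l < ceilDiv k (suc m) → f l ≡ 0
  vanish l l<⌈k/m⌉ =
    trans (cong ((n C l) *_) (binomR-vanish (suc m) l k (<ceilDiv⇒*< m k l l<⌈k/m⌉))) (ℕP.*-zeroʳ (n C l))

sum-binomR-C : ∀ m n k →
  + Σℕ[ k , m * n ] (λ l → binomR m n l * (l C k))
    ≡ Σℤ[ 0 , n ] (λ j → (ℤ.- + 1) ℤ.^ (n ∸ j) ℤ.* + ((n C j) * (((m + 1) * j) C (k + n))))
sum-binomR-C m n k = begin
  + Σℕ[ k , m * n ] f              ≡⟨ cong +_ (sumFT≡⨁< _+_ 0 (λ _ → refl) k (m * n) f vanish) ⟩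
  + ∑ℕ< (suc (m * n)) f            ≡⟨ pos-∑ℕ< (suc (m * n)) f ⟩
  ∑ℤ< (suc (m * n)) (+_ ∘ f)       ≡⟨ ⨁<-cong ℤ._+_ (+ 0) (suc (m * n)) (λ l → ℤP.pos-* (binomR m n l) (l C k)) ⟩
  ∑ℤ< (suc (m * n)) f′             ≡⟨ cong (λ L → ∑ℤ< L f′) (length-powP-pr m n) ⟨
  ∑ℤ< (length (powP (pr m) n)) f′  ≡⟨ sum-binomR-C-ℤ m n k ⟩
  ∑ℤ< (suc n) g                    ≡⟨ sumFT≡⨁< ℤ._+_ (+ 0) ℤP.+-identityˡ 0 n g (λ _ ()) ⟨
  Σℤ[ 0 , n ] g                    ∎
  where
  open ≡-Reasoning
  f = λ l → binomR m n l * (l C k)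
  f′ = λ l → + binomR m n l ℤ.* + (l C k)
  g = λ j → (ℤ.- + 1) ℤ.^ (n ∸ j) ℤ.* + ((n C j) * (((m + 1) * j) C (k + n)))
  vanish : ∀ l → l < k → f l ≡ 0
  vanish l l<k = trans (cong (binomR m n l *_) (k>n⇒nCk≡0 l<k)) (ℕP.*-zeroʳ (binomR m n l))

mainTheorem13 : (m : ℕ) → 1 ≤ m → .{{_ : NonZero m}} → (n k : ℕ) →
    (Σℕ[ ceilDiv k m , n ] (λ l → (n C l) * binomR m l k)
      ≡ Σℕ[ 0 , n ] (λ j → 2 ^ (n ∸ j) * (n C j) * binomRℤ (m ∸ 1) j (+ k ℤ.- + j)))
  × ((+ Σℕ[ k , m * n ] (λ l → binomR m n l * (l C k)))
      ≡ Σℤ[ 0 , n ] (λ j → (ℤ.- + 1) ℤ.^ (n ∸ j) ℤ.* + ((n C j) * (((m + 1) * j) C (k + n)))))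
mainTheorem13 (suc m) _ n k = sum-C-binomR m n k , sum-binomR-C (suc m) n k
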